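{- Let $S$ be a nonempty finite multiset of positive integers, let $m=\max(S)$ and let $n=|S|$ (counting multiplicities). Then there exists a poset $(P,\leq)$ with $|P|=m+n-1$ whose multiset of cardinalities of maximal chains equals $S$.
   Context: A chain in a poset is a subset any two elements of which are comparable; a chain is maximal if it is not properly contained in any other chain. The multiset of cardinalities of maximal chains of a finite poset $P$ contains one entry $|C|$ for each maximal chain $C$ of $P$. -}

module Defs where

open import Data.Nat using (ℕ; zero; suc; _+_; _∸_)
open import Data.Bool using (Bool; true; false)
open import Data.Fin using (Fin)
open import Data.Fin.Subset using (Subset; _∈_; _⊂_; ∣_∣)
open import Data.Vec using (Vec; []; _∷_)
open import Data.List using (List; []; _∷_; map; _++_; filter; foldr)
open import Data.Sum using (_⊎_)
open import Data.Product using (Σ; _×_)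
open import Relation.Nullary using (¬_)
open import Relation.Unary using (Pred; Decidable)
open import Relation.Binary using (Rel)
open import Relation.Binary.PropositionalEquality using (_≡_)
open import Relation.Binary.Structures using (IsDecPartialOrder)
open import Level using (0ℓ)

-- A finite poset whose carrier is Fin k (so |P| = k), with a decidable order
-- (every order on a finite set is classically decidable).
record FinPoset (k : ℕ) : Set₁ where
  field
    _≤_ : Rel (Fin k) 0ℓ
    isDecPartialOrder : IsDecPartialOrder _≡_ _≤_

IsChain : ∀ {k} → Rel (Fin k) 0ℓ → Subset k → Set
IsChain _≤_ c = ∀ x y → x ∈ c → y ∈ c → (x ≤ y) ⊎ (y ≤ x)

IsMaximalChain : ∀ {k} → Rel (Fin k) 0ℓ → Subset k → Set
IsMaximalChain _≤_ c = IsChain _≤_ c × (∀ d → IsChain _≤_ d → ¬ (c ⊂ d))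

allSubsets : ∀ k → List (Subset k)
allSubsets zero = [] ∷ []
allSubsets (suc k) = map (false ∷_) (allSubsets k) ++ map (true ∷_) (allSubsets k)

maxChainCards : ∀ {k} (_≤_ : Rel (Fin k) 0ℓ) →
                Decidable (IsMaximalChain _≤_) → List ℕ
maxChainCards {k} _≤_ dec = map ∣_∣ (filter dec (allSubsets k))

maxList : List ℕ → ℕ
maxList = foldr Data.Nat._⊔_ 0

module Submission where

-- Write M = max S = n + 1 and s₁, …, s_t for the remaining members of S, so t = |S| − 1.
-- Take a spine c₀ < ⋯ < cₙ and points x₁, …, x_t, where x_j lies above exactly the
-- r_j = s_j − 1 spine points c₀, …, c_{r_j − 1} and is incomparable to everything else.
-- Every maximal chain is the set of points comparable to one of its members: the spine is
-- the set of points comparable to cₙ (no x_j is above cₙ, as s_j ≤ M), and a maximal chain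
-- through x_j is c₀ < ⋯ < c_{r_j − 1} < x_j.  So the chain sizes are M and the s_j, on
-- M + t = max S + |S| − 1 points.

open import Defs
open import Data.Nat using (ℕ; zero; suc; _+_; _∸_; _>_)
import Data.Nat as ℕ
import Data.Nat.Properties as ℕ
open import Data.Bool using (true; false)
open import Data.Bool.Properties using (T-≡)
open import Data.Fin as Fin using (Fin)
import Data.Fin.Properties as Fin
open import Data.Fin.Subset using (Subset; _∈_; _⊆_; ∣_∣; ⊤; ⊥; ⁅_⁆)
open import Data.Fin.Subset.Properties
  using (_∈?_; _⊂?_; ⊆-antisym; anySubset?; ∈⊤; ∉⊥; ∣⊤∣≡n; ∣⊥∣≡0; ∣⁅x⁆∣≡1; x∈⁅y⁆⇔x≡y)
open import Data.Vec as Vec using ([]; _∷_; tabulate)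
open import Data.Vec.Properties using (∷-injectiveʳ; lookup∘tabulate; []=⇒lookup; lookup⇒[]=)
open import Data.List as List using (List; []; _∷_; length; filter; map)
import Data.List.Properties as List
open import Data.List.Relation.Unary.All as All using (All; []; _∷_)
import Data.List.Relation.Unary.All.Properties as All
open import Data.List.Relation.Unary.AllPairs using ([]; _∷_)
open import Data.List.Relation.Unary.Any using (here; there)
open import Data.List.Relation.Unary.Unique.Propositional using (Unique)
import Data.List.Relation.Unary.Unique.Propositional.Properties as Unique
open import Data.List.Relation.Binary.Permutation.Propositional using (_↭_; ↭-sym; ↭-trans; ↭-reflexive)
open import Data.List.Relation.Binary.Permutation.Propositional.Properties
  using (map⁺; shift; All-resp-↭; ↭-length)
open import Data.List.Relation.Binary.BagAndSetEquality using (∼bag⇒↭)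
open import Data.List.Membership.Propositional using () renaming (_∈_ to _∈ₗ_)
open import Data.List.Membership.Propositional.Properties
  using ( ∈-map⁺; ∈-map⁻; ∈-++⁺ˡ; ∈-++⁺ʳ; ∈-filter⁺; ∈-filter⁻; ∈-tabulate⁺; ∈-tabulate⁻; ∈-lookup; ∈-∃++
        ; foldr-selective)
open import Data.List.Membership.Propositional.Properties.WithK using (unique∧set⇒bag)
open import Data.Product using (Σ; _×_; _,_; proj₁; proj₂; ∃)
open import Data.Sum as Sum using (_⊎_; inj₁; inj₂)
open import Function using (_∘_; _⇔_; mk⇔; Equivalence)
open import Function.Construct.Identity using (⇔-id)
open import Function.Construct.Composition using (_⇔-∘_)
open import Function.Construct.Symmetry using (⇔-sym)
open import Relation.Nullary using (¬_; yes; no; ⌊_⌋; contradiction; ¬?; _×-dec_; _⊎-dec_; _→-dec_)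
import Relation.Nullary.Decidable as Dec
open import Relation.Unary using (Pred; Decidable)
open import Relation.Binary using (Rel)
import Relation.Binary.Definitions as B
open import Relation.Binary.Structures using (IsDecPartialOrder)
open import Relation.Binary.PropositionalEquality
  using (_≡_; _≢_; refl; sym; trans; cong; cong₂; subst; isEquivalence; module ≡-Reasoning)
open import Level using (0ℓ)

∈-allSubsets : ∀ {k} (c : Subset k) → c ∈ₗ allSubsets k
∈-allSubsets [] = here refl
∈-allSubsets (false ∷ c) = ∈-++⁺ˡ (∈-map⁺ (false ∷_) (∈-allSubsets c))
∈-allSubsets {suc k} (true ∷ c) =
  ∈-++⁺ʳ (map (false ∷_) (allSubsets k)) (∈-map⁺ (true ∷_) (∈-allSubsets c))

allSubsets-unique : ∀ k → Unique (allSubsets k)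
allSubsets-unique zero = [] ∷ []
allSubsets-unique (suc k) = Unique.++⁺
  (Unique.map⁺ ∷-injectiveʳ (allSubsets-unique k)) (Unique.map⁺ ∷-injectiveʳ (allSubsets-unique k)) disjoint
  where
  disjoint : ∀ {c} → ¬ (c ∈ₗ map (false ∷_) (allSubsets k) × c ∈ₗ map (true ∷_) (allSubsets k))
  disjoint (c∈false , c∈true) with ∈-map⁻ (false ∷_) c∈false | ∈-map⁻ (true ∷_) c∈true
  ... | _ , _ , refl | _ , _ , ()

filter-allSubsets-↭ : ∀ {k} {P : Pred (Subset k) 0ℓ} (P? : Decidable P) {cs : List (Subset k)} →
  Unique cs → (∀ {c} → P c ⇔ c ∈ₗ cs) → filter P? (allSubsets k) ↭ cs
filter-allSubsets-↭ {k} P? cs-unique P⇔∈cs = ∼bag⇒↭ (unique∧set⇒bag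
  (Unique.filter⁺ P? (allSubsets-unique k)) cs-unique
  (mk⇔ (Equivalence.to P⇔∈cs ∘ proj₂ ∘ ∈-filter⁻ P? {xs = allSubsets k})
       (λ c∈cs → ∈-filter⁺ P? (∈-allSubsets _) (Equivalence.from P⇔∈cs c∈cs))))

subset : ∀ {n} {P : Pred (Fin n) 0ℓ} → Decidable P → Subset n
subset P? = tabulate (⌊_⌋ ∘ P?)

module _ {n} {P : Pred (Fin n) 0ℓ} (P? : Decidable P) where

  ∈-subset : ∀ {x} → x ∈ subset P? ⇔ P x
  ∈-subset {x} = mk⇔
    (λ x∈ → Dec.toWitness (Equivalence.from T-≡ (trans (sym (lookup∘tabulate _ x)) ([]=⇒lookup x∈))))
    (λ px → lookup⇒[]= x _ (trans (lookup∘tabulate _ x) (Equivalence.to T-≡ (Dec.fromWitness px))))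

  subset-≡ : ∀ {p} → (∀ {x} → P x ⇔ x ∈ p) → subset P? ≡ p
  subset-≡ P⇔∈p = ⊆-antisym
    (Equivalence.to P⇔∈p ∘ Equivalence.to ∈-subset)
    (Equivalence.from ∈-subset ∘ Equivalence.from P⇔∈p)

subset-++ : ∀ {m n} {P : Pred (Fin (m + n)) 0ℓ} (P? : Decidable P) →
  subset P? ≡ subset (P? ∘ (Fin._↑ˡ n)) Vec.++ subset (P? ∘ (m Fin.↑ʳ_))
subset-++ {zero} P? = refl
subset-++ {suc m} P? = cong (⌊ P? Fin.zero ⌋ ∷_) (subset-++ {m} (P? ∘ Fin.suc))

∣++∣ : ∀ {m n} (p : Subset m) (q : Subset n) → ∣ p Vec.++ q ∣ ≡ ∣ p ∣ + ∣ q ∣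
∣++∣ [] q = refl
∣++∣ (true ∷ p) q = cong suc (∣++∣ p q)
∣++∣ (false ∷ p) q = ∣++∣ p q

∣subset∣-initial : ∀ {n r} {P : Pred (Fin n) 0ℓ} (P? : Decidable P) →
  (∀ {a} → P a ⇔ Fin.toℕ a ℕ.< r) → r ℕ.≤ n → ∣ subset P? ∣ ≡ r
∣subset∣-initial {zero} P? P⇔ ℕ.z≤n = refl
∣subset∣-initial {suc n} P? P⇔ r≤n with P? Fin.zero
∣subset∣-initial {suc n} {zero} P? P⇔ r≤n | yes P0 = contradiction (Equivalence.to P⇔ P0) λ ()
∣subset∣-initial {suc n} {zero} P? P⇔ r≤n | no _ =
  ∣subset∣-initial (P? ∘ Fin.suc) (mk⇔ (λ P1+a → contradiction (Equivalence.to P⇔ P1+a) λ ()) λ ()) ℕ.z≤n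
∣subset∣-initial {suc n} {suc r} P? P⇔ (ℕ.s≤s r≤n) | yes _ = cong suc
  (∣subset∣-initial (P? ∘ Fin.suc) (mk⇔ (ℕ.s≤s⁻¹ ∘ Equivalence.to P⇔) (Equivalence.from P⇔ ∘ ℕ.s≤s)) r≤n)
∣subset∣-initial {suc n} {suc r} P? P⇔ r≤n | no ¬P0 = contradiction (Equivalence.from P⇔ (ℕ.s≤s ℕ.z≤n)) ¬P0

-- Chains

Comparable : ∀ {A : Set} → Rel A 0ℓ → Rel A 0ℓ
Comparable _≤_ x y = x ≤ y ⊎ y ≤ x

ComparablesFormChain : ∀ {A : Set} → Rel A 0ℓ → A → Set
ComparablesFormChain _≤_ w = ∀ x y → Comparable _≤_ x w → Comparable _≤_ y w → Comparable _≤_ x y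

module _ {k} {_≤_ : Rel (Fin k) 0ℓ} where

  isChain? : B.Decidable _≤_ → Decidable (IsChain _≤_)
  isChain? _≤?_ c = Fin.all? λ x → Fin.all? λ y →
    (x ∈? c) →-dec (y ∈? c) →-dec ((x ≤? y) ⊎-dec (y ≤? x))

  isMaximalChain? : B.Decidable _≤_ → Decidable (IsMaximalChain _≤_)
  isMaximalChain? _≤?_ c = isChain? _≤?_ c ×-dec Dec.map
    (mk⇔ (λ ¬ext d d-chain c⊂d → ¬ext (d , d-chain , c⊂d)) (λ max (d , d-chain , c⊂d) → max d d-chain c⊂d))
    (¬? (anySubset? λ d → isChain? _≤?_ d ×-dec c ⊂? d))

  maximal-⊆-chain⇒≡ : ∀ {c d} → IsMaximalChain _≤_ c → IsChain _≤_ d → c ⊆ d → c ≡ d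
  maximal-⊆-chain⇒≡ {c} {d} (_ , max) d-chain c⊆d = ⊆-antisym c⊆d d⊆c
    where
    d⊆c : d ⊆ c
    d⊆c {x} x∈d with x ∈? c
    ... | yes x∈c = x∈c
    ... | no x∉c = contradiction ((λ {_} → c⊆d) , x , x∈d , x∉c) (max d d-chain)

module _ {k} (P : FinPoset k) where
  open FinPoset P
  open IsDecPartialOrder isDecPartialOrder using (_≤?_) renaming (refl to ≤-refl)

  comparable? : ∀ w → Decidable λ x → Comparable _≤_ x w
  comparable? w x = (x ≤? w) ⊎-dec (w ≤? x)

  comparables : Fin k → Subset k
  comparables w = subset (comparable? w)

  ∈-comparables : ∀ {x} w → x ∈ comparables w ⇔ Comparable _≤_ x w
  ∈-comparables w = ∈-subset (comparable? w)

  w∈comparables : ∀ w → w ∈ comparables w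
  w∈comparables w = Equivalence.from (∈-comparables w) (inj₁ ≤-refl)

  comparables-isChain : ∀ w → ComparablesFormChain _≤_ w → IsChain _≤_ (comparables w)
  comparables-isChain w close x y x∈ y∈ =
    close x y (Equivalence.to (∈-comparables w) x∈) (Equivalence.to (∈-comparables w) y∈)

  comparables-maximal : ∀ w → ComparablesFormChain _≤_ w → IsMaximalChain _≤_ (comparables w)
  comparables-maximal w close = comparables-isChain w close , λ d d-chain (⊆d , z , z∈d , z∉) →
    z∉ (Equivalence.from (∈-comparables w) (d-chain z w z∈d (⊆d (w∈comparables w))))

  maximal-∋⇒≡comparables : ∀ {c w} → IsMaximalChain _≤_ c → w ∈ c → ComparablesFormChain _≤_ w →
    c ≡ comparables w
  maximal-∋⇒≡comparables {w = w} max w∈c close = maximal-⊆-chain⇒≡ max (comparables-isChain w close)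
    λ {x} x∈c → Equivalence.from (∈-comparables w) (proj₁ max x w x∈c w∈c)

-- The spine-with-leaves poset

Realises : ℕ → List ℕ → Set₁
Realises k S = Σ (FinPoset k) λ P →
  Σ (Decidable (IsMaximalChain (FinPoset._≤_ P))) λ dec → maxChainCards (FinPoset._≤_ P) dec ↭ S

Realises-resp-↭ : ∀ {k S S′} → S ↭ S′ → Realises k S → Realises k S′
Realises-resp-↭ S↭S′ (P , dec , cards↭S) = P , dec , ↭-trans cards↭S S↭S′

module SpineWithLeaves (n t : ℕ) (r : Fin t → ℕ) (r≤n : ∀ j → r j ℕ.≤ n) where

  Point : Set
  Point = Fin (suc n) ⊎ Fin t

  data _⊑_ : Rel Point 0ℓ where
    spine≤spine : ∀ {a b} → a Fin.≤ b → inj₁ a ⊑ inj₁ b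
    spine<leaf : ∀ {a j} → Fin.toℕ a ℕ.< r j → inj₁ a ⊑ inj₂ j
    leaf≤leaf : ∀ {j} → inj₂ j ⊑ inj₂ j

  ⊑-refl : ∀ {e} → e ⊑ e
  ⊑-refl {inj₁ a} = spine≤spine (Fin.≤-refl {x = a})
  ⊑-refl {inj₂ j} = leaf≤leaf

  ⊑-trans : ∀ {e f g} → e ⊑ f → f ⊑ g → e ⊑ g
  ⊑-trans (spine≤spine a≤b) (spine≤spine b≤c) = spine≤spine (Fin.≤-trans a≤b b≤c)
  ⊑-trans (spine≤spine a≤b) (spine<leaf b<r) = spine<leaf (ℕ.≤-<-trans a≤b b<r)
  ⊑-trans (spine<leaf a<r) leaf≤leaf = spine<leaf a<r
  ⊑-trans leaf≤leaf leaf≤leaf = leaf≤leaf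

  ⊑-antisym : ∀ {e f} → e ⊑ f → f ⊑ e → e ≡ f
  ⊑-antisym (spine≤spine a≤b) (spine≤spine b≤a) = cong inj₁ (Fin.≤-antisym a≤b b≤a)
  ⊑-antisym leaf≤leaf leaf≤leaf = refl

  _⊑?_ : B.Decidable _⊑_
  inj₁ a ⊑? inj₁ b = Dec.map′ spine≤spine (λ { (spine≤spine a≤b) → a≤b }) (a Fin.≤? b)
  inj₁ a ⊑? inj₂ j = Dec.map′ spine<leaf (λ { (spine<leaf a<r) → a<r }) (Fin.toℕ a ℕ.<? r j)
  inj₂ i ⊑? inj₁ b = no λ ()
  inj₂ i ⊑? inj₂ j = Dec.map′ (λ { refl → leaf≤leaf }) (λ { leaf≤leaf → refl }) (i Fin.≟ j)

  _∼_ : Rel Point 0ℓ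
  _∼_ = Comparable _⊑_

  spine∼spine : ∀ a b → inj₁ a ∼ inj₁ b
  spine∼spine a b = Sum.map spine≤spine spine≤spine (Fin.≤-total a b)

  spine∼leaf⇔ : ∀ {a j} → inj₁ a ∼ inj₂ j ⇔ Fin.toℕ a ℕ.< r j
  spine∼leaf⇔ = mk⇔ (λ { (inj₁ (spine<leaf a<r)) → a<r ; (inj₂ ()) }) (inj₁ ∘ spine<leaf)

  leaf∼leaf⇔ : ∀ {i j} → inj₂ i ∼ inj₂ j ⇔ i ≡ j
  leaf∼leaf⇔ = mk⇔ (λ { (inj₁ leaf≤leaf) → refl ; (inj₂ leaf≤leaf) → refl }) (λ { refl → inj₁ leaf≤leaf })

  topPoint : Point
  topPoint = inj₁ (Fin.fromℕ n)

  leaf≁top : ∀ {j} → ¬ (inj₂ j ∼ topPoint)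
  leaf≁top {j} (inj₂ (spine<leaf n<r)) = ℕ.<⇒≱ (subst (ℕ._< r j) (Fin.toℕ-fromℕ n) n<r) (r≤n j)

  ⊑-top-comparablesFormChain : ComparablesFormChain _⊑_ topPoint
  ⊑-top-comparablesFormChain (inj₁ a) (inj₁ b) _ _ = spine∼spine a b
  ⊑-top-comparablesFormChain (inj₂ _) _ e∼top _ = contradiction e∼top leaf≁top
  ⊑-top-comparablesFormChain _ (inj₂ _) _ f∼top = contradiction f∼top leaf≁top

  ⊑-leaf-comparablesFormChain : ∀ j → ComparablesFormChain _⊑_ (inj₂ j)
  ⊑-leaf-comparablesFormChain j (inj₁ a) (inj₁ b) _ _ = spine∼spine a b
  ⊑-leaf-comparablesFormChain j (inj₁ a) (inj₂ i) a∼j i∼j with Equivalence.to leaf∼leaf⇔ i∼j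
  ... | refl = a∼j
  ⊑-leaf-comparablesFormChain j (inj₂ i) f i∼j f∼j with Equivalence.to leaf∼leaf⇔ i∼j
  ... | refl = Sum.swap f∼j

  k : ℕ
  k = suc n + t

  point : Fin k → Point
  point = Fin.splitAt (suc n)

  _≼_ : Rel (Fin k) 0ℓ
  p ≼ q = point p ⊑ point q

  _≼?_ : B.Decidable _≼_
  p ≼? q = point p ⊑? point q

  point-injective : ∀ {p q} → point p ≡ point q → p ≡ q
  point-injective {p} {q} eq = begin
    p                            ≡⟨ Fin.join-splitAt (suc n) t p ⟨
    Fin.join (suc n) t (point p) ≡⟨ cong (Fin.join (suc n) t) eq ⟩
    Fin.join (suc n) t (point q) ≡⟨ Fin.join-splitAt (suc n) t q ⟩
    q                            ∎
    where open ≡-Reasoning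

  poset : FinPoset k
  poset = record
    { _≤_ = _≼_
    ; isDecPartialOrder = record
      { isPartialOrder = record
        { isPreorder = record
          { isEquivalence = isEquivalence
          ; reflexive = λ { refl → ⊑-refl }
          ; trans = ⊑-trans
          }
        ; antisym = λ p≼q q≼p → point-injective (⊑-antisym p≼q q≼p)
        }
      ; _≟_ = Fin._≟_
      ; _≤?_ = _≼?_
      }
    }

  spine : Fin (suc n) → Fin k
  spine a = a Fin.↑ˡ t

  leaf : Fin t → Fin k
  leaf j = suc n Fin.↑ʳ j

  top : Fin k
  top = spine (Fin.fromℕ n)

  point-spine : ∀ a → point (spine a) ≡ inj₁ a
  point-spine a = Fin.splitAt-↑ˡ (suc n) a t

  point-leaf : ∀ j → point (leaf j) ≡ inj₂ j
  point-leaf j = Fin.splitAt-↑ʳ (suc n) t j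

  comparable⇔ : ∀ p q {e f} → point p ≡ e → point q ≡ f → Comparable _≼_ p q ⇔ e ∼ f
  comparable⇔ p q refl refl = ⇔-id _

  top-comparablesFormChain : ComparablesFormChain _≼_ top
  top-comparablesFormChain x y =
    subst (ComparablesFormChain _⊑_) (sym (point-spine _)) ⊑-top-comparablesFormChain (point x) (point y)

  leaf-comparablesFormChain : ∀ j → ComparablesFormChain _≼_ (leaf j)
  leaf-comparablesFormChain j x y =
    subst (ComparablesFormChain _⊑_) (sym (point-leaf j)) (⊑-leaf-comparablesFormChain j) (point x) (point y)

  spineChain : Subset k
  spineChain = comparables poset top

  leafChain : Fin t → Subset k
  leafChain j = comparables poset (leaf j)

  ∣spineChain∣ : ∣ spineChain ∣ ≡ suc n
  ∣spineChain∣ = begin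
    ∣ spineChain ∣              ≡⟨ cong ∣_∣ (subset-++ {suc n} {t} (comparable? poset top)) ⟩
    ∣ onSpine Vec.++ onLeaves ∣ ≡⟨ cong₂ (λ p q → ∣ p Vec.++ q ∣) onSpine≡⊤ onLeaves≡⊥ ⟩
    ∣ ⊤ {suc n} Vec.++ ⊥ {t} ∣  ≡⟨ ∣++∣ (⊤ {suc n}) (⊥ {t}) ⟩
    ∣ ⊤ {suc n} ∣ + ∣ ⊥ {t} ∣   ≡⟨ cong₂ _+_ (∣⊤∣≡n (suc n)) (∣⊥∣≡0 t) ⟩
    suc n + 0                   ≡⟨ ℕ.+-identityʳ (suc n) ⟩
    suc n                       ∎
    where
    open ≡-Reasoning
    onSpine : Subset (suc n)
    onSpine = subset (comparable? poset top ∘ spine)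
    onLeaves : Subset t
    onLeaves = subset (comparable? poset top ∘ leaf)
    onSpine≡⊤ : onSpine ≡ ⊤
    onSpine≡⊤ = subset-≡ (comparable? poset top ∘ spine) λ {a} →
      mk⇔ (λ _ → ∈⊤) (λ _ → spine∼spine a (Fin.fromℕ n))
        ⇔-∘ comparable⇔ (spine a) top (point-spine a) (point-spine (Fin.fromℕ n))
    onLeaves≡⊥ : onLeaves ≡ ⊥
    onLeaves≡⊥ = subset-≡ (comparable? poset top ∘ leaf) λ {j} →
      mk⇔ (λ j∼top → contradiction j∼top leaf≁top) (λ j∈⊥ → contradiction j∈⊥ ∉⊥)
        ⇔-∘ comparable⇔ (leaf j) top (point-leaf j) (point-spine (Fin.fromℕ n))

  ∣leafChain∣ : ∀ j → ∣ leafChain j ∣ ≡ r j + 1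
  ∣leafChain∣ j = begin
    ∣ leafChain j ∣             ≡⟨ cong ∣_∣ (subset-++ {suc n} {t} (comparable? poset (leaf j))) ⟩
    ∣ onSpine Vec.++ onLeaves ∣ ≡⟨ ∣++∣ onSpine onLeaves ⟩
    ∣ onSpine ∣ + ∣ onLeaves ∣  ≡⟨ cong₂ _+_ ∣onSpine∣ (cong ∣_∣ onLeaves≡⁅j⁆) ⟩
    r j + ∣ ⁅ j ⁆ ∣             ≡⟨ cong (r j +_) (∣⁅x⁆∣≡1 j) ⟩
    r j + 1                     ∎
    where
    open ≡-Reasoning
    onSpine : Subset (suc n)
    onSpine = subset (comparable? poset (leaf j) ∘ spine)
    onLeaves : Subset t
    onLeaves = subset (comparable? poset (leaf j) ∘ leaf)
    ∣onSpine∣ : ∣ onSpine ∣ ≡ r j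
    ∣onSpine∣ = ∣subset∣-initial (comparable? poset (leaf j) ∘ spine)
      (λ {a} → spine∼leaf⇔ ⇔-∘ comparable⇔ (spine a) (leaf j) (point-spine a) (point-leaf j))
      (ℕ.m≤n⇒m≤1+n (r≤n j))
    onLeaves≡⁅j⁆ : onLeaves ≡ ⁅ j ⁆
    onLeaves≡⁅j⁆ = subset-≡ (comparable? poset (leaf j) ∘ leaf) λ {i} →
      ⇔-sym x∈⁅y⁆⇔x≡y ⇔-∘ (leaf∼leaf⇔ ⇔-∘ comparable⇔ (leaf i) (leaf j) (point-leaf i) (point-leaf j))

  leaf∉spineChain : ∀ j → ¬ (leaf j ∈ spineChain)
  leaf∉spineChain j = leaf≁top
    ∘ Equivalence.to (comparable⇔ (leaf j) top (point-leaf j) (point-spine _))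
    ∘ Equivalence.to (∈-comparables poset top)

  leaf∈leafChain⇒≡ : ∀ {i j} → leaf i ∈ leafChain j → i ≡ j
  leaf∈leafChain⇒≡ {i} {j} = Equivalence.to leaf∼leaf⇔
    ∘ Equivalence.to (comparable⇔ (leaf i) (leaf j) (point-leaf i) (point-leaf j))
    ∘ Equivalence.to (∈-comparables poset (leaf j))

  spineChain≢leafChain : ∀ j → spineChain ≢ leafChain j
  spineChain≢leafChain j eq = leaf∉spineChain j (subst (leaf j ∈_) (sym eq) (w∈comparables poset (leaf j)))

  leafChain-injective : ∀ {i j} → leafChain i ≡ leafChain j → i ≡ j
  leafChain-injective {i} eq = leaf∈leafChain⇒≡ (subst (leaf i ∈_) eq (w∈comparables poset (leaf i)))

  spinePoint∈spineChain : ∀ {p a} → point p ≡ inj₁ a → p ∈ spineChain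
  spinePoint∈spineChain {p} {a} eq = Equivalence.from (∈-comparables poset top)
    (Equivalence.from (comparable⇔ p top eq (point-spine _)) (spine∼spine a (Fin.fromℕ n)))

  maximal⇒spineChain⊎leafChain : ∀ {c} → IsMaximalChain _≼_ c → c ≡ spineChain ⊎ ∃ λ j → c ≡ leafChain j
  maximal⇒spineChain⊎leafChain {c} max with Fin.any? (λ j → leaf j ∈? c)
  ... | yes (j , leaf∈c) = inj₂ (j , maximal-∋⇒≡comparables poset max leaf∈c (leaf-comparablesFormChain j))
  ... | no no-leaf =
    inj₁ (maximal-⊆-chain⇒≡ max (comparables-isChain poset top top-comparablesFormChain) c⊆spineChain)
    where
    c⊆spineChain : c ⊆ spineChain
    c⊆spineChain {p} p∈c with point p in eq
    ... | inj₁ a = spinePoint∈spineChain eq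
    ... | inj₂ j = contradiction (j , subst (_∈ c) (sym (Fin.splitAt⁻¹-↑ʳ eq)) p∈c) no-leaf

  maximalChains : List (Subset k)
  maximalChains = spineChain ∷ List.tabulate leafChain

  maximalChains-unique : Unique maximalChains
  maximalChains-unique = All.tabulate⁺ spineChain≢leafChain ∷ Unique.tabulate⁺ leafChain-injective

  isMaximalChain⇔∈maximalChains : ∀ {c} → IsMaximalChain _≼_ c ⇔ c ∈ₗ maximalChains
  isMaximalChain⇔∈maximalChains = mk⇔ to from
    where
    to : ∀ {c} → IsMaximalChain _≼_ c → c ∈ₗ maximalChains
    to max with maximal⇒spineChain⊎leafChain max
    ... | inj₁ refl = here refl
    ... | inj₂ (j , refl) = there (∈-tabulate⁺ j)
    from : ∀ {c} → c ∈ₗ maximalChains → IsMaximalChain _≼_ c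
    from (here refl) = comparables-maximal poset top top-comparablesFormChain
    from (there c∈leafChains) with ∈-tabulate⁻ c∈leafChains
    ... | j , refl = comparables-maximal poset (leaf j) (leaf-comparablesFormChain j)

  realisation : Realises k (suc n ∷ List.tabulate (λ j → r j + 1))
  realisation = poset , isMaximalChain? _≼?_ , ↭-trans
    (map⁺ ∣_∣ (filter-allSubsets-↭ (isMaximalChain? _≼?_)
                                   maximalChains-unique isMaximalChain⇔∈maximalChains))
    (↭-reflexive (cong₂ _∷_ ∣spineChain∣
      (trans (List.map-tabulate leafChain ∣_∣) (List.tabulate-cong ∣leafChain∣))))

realisable : ∀ {M} T → 0 ℕ.< M → All (0 ℕ.<_) T → All (ℕ._≤ M) T → Realises (M + length T) (M ∷ T)
realisable {suc n} T (ℕ.s≤s ℕ.z≤n) T-pos T≤M =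
  subst (Realises (suc n + length T) ∘ (suc n ∷_)) sizes≡T (SpineWithLeaves.realisation n (length T) r r≤n)
  where
  r : Fin (length T) → ℕ
  r j = List.lookup T j ∸ 1
  r≤n : ∀ j → r j ℕ.≤ n
  r≤n j = ℕ.∸-monoˡ-≤ 1 (All.lookup T≤M (∈-lookup j))
  sizes≡T : List.tabulate (λ j → r j + 1) ≡ T
  sizes≡T = trans
    (List.tabulate-cong λ j → ℕ.m∸n+n≡m (All.lookup T-pos (∈-lookup j)))
    (List.tabulate-lookup T)

≤-maxList : ∀ xs → All (ℕ._≤ maxList xs) xs
≤-maxList [] = []
≤-maxList (x ∷ xs) = ℕ.m≤m⊔n x (maxList xs) ∷ All.map (ℕ.m≤n⇒m≤o⊔n x) (≤-maxList xs)

maxList-∈ : ∀ {xs} → xs ≢ [] → All (0 ℕ.<_) xs → maxList xs ∈ₗ xs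
maxList-∈ {[]} []≢[] _ = contradiction refl []≢[]
maxList-∈ {x ∷ xs} _ (0<x ∷ _) with foldr-selective ℕ.⊔-sel 0 (x ∷ xs)
... | inj₂ max∈ = max∈
... | inj₁ max≡0 = contradiction (subst (x ℕ.≤_) max≡0 (ℕ.m≤m⊔n x (maxList xs))) (ℕ.<⇒≱ 0<x)

∈⇒↭∷ : ∀ {A : Set} {v : A} {xs} → v ∈ₗ xs → ∃ λ ys → xs ↭ v ∷ ys
∈⇒↭∷ {v = v} v∈xs with ∈-∃++ v∈xs
... | ys , zs , refl = ys List.++ zs , shift v ys zs

mainTheorem4 : (S : List ℕ) → S ≢ [] → All (λ s → s > 0) S →
    Σ (FinPoset (maxList S + length S ∸ 1)) λ P →
      Σ (Decidable (IsMaximalChain (FinPoset._≤_ P))) λ dec →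
        maxChainCards (FinPoset._≤_ P) dec ↭ S
mainTheorem4 S S≢[] S-pos =
  subst (λ k → Realises k S) size≡ (Realises-resp-↭ (↭-sym S↭M∷T) (realisable T M-pos T-pos T≤M))
  where
  M : ℕ
  M = maxList S
  M∈S : M ∈ₗ S
  M∈S = maxList-∈ S≢[] S-pos
  T : List ℕ
  T = proj₁ (∈⇒↭∷ M∈S)
  S↭M∷T : S ↭ M ∷ T
  S↭M∷T = proj₂ (∈⇒↭∷ M∈S)
  M-pos : 0 ℕ.< M
  M-pos = All.lookup S-pos M∈S
  T-pos : All (0 ℕ.<_) T
  T-pos = All.tail (All-resp-↭ S↭M∷T S-pos)
  T≤M : All (ℕ._≤ M) T
  T≤M = All.tail (All-resp-↭ S↭M∷T (≤-maxList S))
  size≡ : M + length T ≡ M + length S ∸ 1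
  size≡ = begin
    M + length T           ≡⟨ cong (_∸ 1) (ℕ.+-suc M (length T)) ⟨
    M + suc (length T) ∸ 1 ≡⟨ cong (λ l → M + l ∸ 1) (↭-length S↭M∷T) ⟨
    M + length S ∸ 1       ∎
    where open ≡-Reasoning
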